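{- Let $k$ be a field of characteristic zero, $H$ the matroid Hopf algebra over $k$, $K$ a commutative $k$-algebra and $a,b\in K$. Then for every matroid $M$, $$\exp_\ast\{a\,\delta_{\mathrm{coloop}}+b\,\delta_{\mathrm{loop}}\}(M)=a^{r(M)}\,b^{n(M)}.$$
   Context: Matroids $M=(E,\mathcal I)$ on finite ground sets; rank $r(A)=\max\{|B|:B\in\mathcal I, B\subseteq A\}$, $r(M)=r(E)$, nullity $n(M)=|E|-r(M)$ (with $0^0=1$). Deletion $M\backslash T$: matroid on $E-T$ with independent sets $\{I\in\mathcal I:I\subseteq E-T\}$; restriction $M|_A=M\backslash(E-A)$; dual $M^\star$: bases are complements of bases of $M$; contraction $M/T=(M^\star\backslash T)^\star$. $U_{r,n}$ is the uniform matroid on $n$ elements whose independent sets are all subsets of size at most $r$. The matroid Hopf algebra $H$ over $k$ has basis the isomorphism classes of matroids, product induced by direct sum, unit the empty matroid $\mathbf 1$, coproduct $\Delta(M)=\sum_{A\subseteq E}M|_A\otimes M/A$, counit $\epsilon(M)=1$ if $E=\emptyset$, else $0$. For linear $f,g:H\to K$, $(f\ast g)(M)=\sum_{A\subseteq E}f(M|_A)g(M/A)$. For a linear map $\delta:H\to K$ with $\delta(\mathbf 1)=0$, $\exp_\ast(\delta)=\sum_{k\ge0}\delta^{\ast k}/k!$ with $\delta^{\ast0}=\epsilon$ (finite on each matroid). $\delta_{\mathrm{loop}}(M)=1$ if $M\cong U_{0,1}$ and $0$ otherwise; $\delta_{\mathrm{coloop}}(M)=1$ if $M\cong U_{1,1}$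 and $0$ otherwise (extended linearly). -}

module Defs where

open import Level using (Level; _⊔_) renaming (suc to lsuc)
open import Algebra.Bundles using (CommutativeRing)
open import Data.Bool using (Bool; true; false; T; _∧_; _∨_; not; if_then_else_)
import Data.Nat as ℕ
open import Data.Nat using (ℕ; zero; suc; _∸_; _<_; _≡ᵇ_; _≤ᵇ_)
open import Data.Vec using (Vec; []; _∷_; lookup)
open import Data.Fin using (Fin)
open import Data.Bool.ListAction using (all; any)
open import Data.List using (List; []; _∷_; _++_; map; foldr; upTo; allFin)
open import Data.Fin.Subset using (Subset; _⊆_; _∈_; _∉_; ⊥; ⁅_⁆; _∪_; _─_; ∣_∣)
open import Data.Product using (∃; _×_)
open import Relation.Nullary using (¬_)

record Field (c ℓ : Level) : Set (lsuc (c ⊔ ℓ)) where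
  field
    commutativeRing : CommutativeRing c ℓ
  open CommutativeRing commutativeRing public
  field
    inv     : (x : Carrier) → ¬ (x ≈ 0#) → Carrier
    inverse : ∀ x (p : ¬ (x ≈ 0#)) → (x * inv x p) ≈ 1#
    0≉1     : ¬ (0# ≈ 1#)

module _ {c ℓ} (R : CommutativeRing c ℓ) where
  open CommutativeRing R
  natCast : ℕ → Carrier
  natCast zero    = 0#
  natCast (suc m) = 1# + natCast m

  -- x ^ m  (with x ^ 0 = 1, so 0 ^ 0 = 1)
  pow : Carrier → ℕ → Carrier
  pow x zero    = 1#
  pow x (suc m) = x * pow x m

  sumR : List Carrier → Carrier
  sumR = foldr _+_ 0#

CharZero : ∀ {c ℓ} → Field c ℓ → Set ℓ
CharZero F = ∀ m → ¬ (natCast commutativeRing (suc m) ≈ 0#)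
  where open Field F

allSubsets : (n : ℕ) → List (Subset n)
allSubsets zero    = [] ∷ []
allSubsets (suc n) = map (true ∷_) (allSubsets n) ++ map (false ∷_) (allSubsets n)

_⊆ᵇ_ : ∀ {n} → Subset n → Subset n → Bool
[]      ⊆ᵇ []      = true
(x ∷ p) ⊆ᵇ (y ∷ q) = (not x ∨ y) ∧ (p ⊆ᵇ q)

-- A matroid with finite ground set E is represented inside
-- an ambient Fin n: E is a subset of Fin n, and the independent sets are
-- given by a (decidable) predicate on subsets of Fin n.  Minors keep the
-- same ambient Fin n, so no relabelling is needed.

record SetSystem (n : ℕ) : Set where
  constructor mkSS
  field
    ground : Subset n
    indep  : Subset n → Bool
open SetSystem public

record IsMatroid {n : ℕ} (M : SetSystem n) : Set where
  field
    indep⊆ground : ∀ I → T (indep M I) → I ⊆ ground M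
    indep-∅      : T (indep M ⊥)
    hereditary   : ∀ I J → J ⊆ I → T (indep M I) → T (indep M J)
    augmentation : ∀ I J → T (indep M I) → T (indep M J) → ∣ I ∣ < ∣ J ∣ →
                   ∃ λ x → x ∈ J × x ∉ I × T (indep M (I ∪ ⁅ x ⁆))

module _ {n : ℕ} (M : SetSystem n) where

  rankOf : Subset n → ℕ
  rankOf A = foldr (λ S m → if indep M S ∧ (S ⊆ᵇ A) then ∣ S ∣ ℕ.⊔ m else m)
                   0 (allSubsets n)

  rank : ℕ
  rank = rankOf (ground M)

  nullity : ℕ
  nullity = ∣ ground M ∣ ∸ rank

  isBasis : Subset n → Bool
  isBasis B = indep M B ∧
    all (λ x → not (lookup (ground M ─ B) x) ∨ not (indep M (B ∪ ⁅ x ⁆))) (allFin n)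

  -- dual: bases are the complements (in E) of the bases of M, so the
  -- independent sets are the subsets of such complements
  dual : SetSystem n
  dual = mkSS (ground M)
    (λ I → any (λ B → isBasis B ∧ (I ⊆ᵇ (ground M ─ B))) (allSubsets n))

  delete : Subset n → SetSystem n
  delete T' = mkSS (ground M ─ T') (λ I → indep M I ∧ (I ⊆ᵇ (ground M ─ T')))

  restrict : Subset n → SetSystem n
  restrict A = delete (ground M ─ A)

contract : ∀ {n} → SetSystem n → Subset n → SetSystem n
contract M T' = dual (delete (dual M) T')

isUniform : ∀ {n} → ℕ → ℕ → SetSystem n → Bool
isUniform {n} r m M = (∣ ground M ∣ ≡ᵇ m) ∧
  all (λ I → if indep M I then ((I ⊆ᵇ ground M) ∧ (∣ I ∣ ≤ᵇ r))
                          else not ((I ⊆ᵇ ground M) ∧ (∣ I ∣ ≤ᵇ r)))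
      (allSubsets n)

-- Characters / linear maps H → K, convolution and exponential.
-- A linear map H → K is determined by its values on matroids.

module HopfExp {c ℓ c' ℓ'} (k : Field c ℓ) (K : CommutativeRing c' ℓ')
               (φ : Field.Carrier k → CommutativeRing.Carrier K)
               (char0 : CharZero k) where

  private
    module k = Field k
  open CommutativeRing K

  Fun : ℕ → Set c'
  Fun n = SetSystem n → Carrier

  ε : ∀ {n} → Fun n
  ε M = if ∣ ground M ∣ ≡ᵇ 0 then 1# else 0#

  δloop : ∀ {n} → Fun n
  δloop M = if isUniform 0 1 M then 1# else 0#

  δcoloop : ∀ {n} → Fun n
  δcoloop M = if isUniform 1 1 M then 1# else 0#

  _⋆_ : ∀ {n} → Fun n → Fun n → Fun n
  (f ⋆ g) M = sumR K (map (λ A → if A ⊆ᵇ ground M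
                                    then f (restrict M A) * g (contract M A)
                                    else 0#) (allSubsets _))

  ⋆pow : ∀ {n} → Fun n → ℕ → Fun n
  ⋆pow δ zero    = ε
  ⋆pow δ (suc j) = δ ⋆ ⋆pow δ j

  invFact : ℕ → k.Carrier
  invFact zero    = k.1#
  invFact (suc j) = invFact j k.* k.inv (natCast k.commutativeRing (suc j)) (char0 j)

  -- exp_⋆(δ)(M) = Σ_j δ^{⋆j}(M)/j!; for δ(1) = 0 all terms with j > |E|
  -- vanish, so the sum is taken over j = 0 … |E|
  exp⋆ : ∀ {n} → Fun n → Fun n
  exp⋆ δ M = sumR K (map (λ j → φ (invFact j) * ⋆pow δ j M)
                         (upTo (suc ∣ ground M ∣)))

module Submission where

-- Write δ = a·δcoloop + b·δloop and W(M) = a^r(M) b^n(M).  The heart of the proof is the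
-- formula for the convolution powers of δ:
--     δ^{⋆j}(M) = j! · W(M)  if |E| = j,   and 0 otherwise.  In (δ ⋆ δ^{⋆j})(M) = Σ_A δ(M|A) δ^{⋆j}(M/A) only the
-- singletons A = {e}, e ∈ E, contribute, because δ vanishes off one-element matroids.  For
-- such e, M|{e} is U_{1,1} or U_{0,1} according as e is a non-loop or a loop, so δ(M|{e}) is
-- a or b; and M/e is again a matroid whose rank (non-loop) or nullity (loop) drops by one,
-- whence δ(M|{e}) · W(M/e) = W(M).  Summing over the |E| elements gives (j+1)! W(M).
-- Finally exp⋆(δ)(M) = Σ_{j ≤ |E|} δ^{⋆j}(M)/j! keeps only the term j = |E|, equal to W(M).

open import Defs
open import Algebra.Bundles using (CommutativeRing)
open import Algebra.Morphism.Structures using (IsRingHomomorphism)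
import Algebra.Properties.Monoid.Sum as MonoidSum
open import Data.Bool using (Bool; true; false; T; _∧_; _∨_; not; if_then_else_)
open import Data.Bool.Properties using (∧-zeroʳ; ∧-identityʳ)
open import Data.Nat as ℕ using (ℕ; zero; suc; _≤_; _<_; _⊔_; _∸_; _≡ᵇ_; _≤ᵇ_; z≤n; s≤s)
import Data.Nat.Properties as ℕₚ
open import Data.Nat.Properties
  using (≤-trans; ≤-antisym; ≤-reflexive; m≤m⊔n; m≤n⊔m; ⊔-identityʳ; ⊔-sel; +-suc;
         m≤m+n; m+[n∸m]≡n; m∸n+n≡m; m≤n⇒m<n∨m≡n; n≮n; n≤0⇒n≡0; +-∸-assoc;
         +-monoˡ-<; m+n≤o⇒m≤o∸n; m+n∸n≡m; ≡ᵇ⇒≡; ≡⇒≡ᵇ; <⇒≢)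
open import Data.Vec using ([]; _∷_; lookup; tail; here; there)
open import Data.Vec.Properties using ([]=⇒lookup; lookup⇒[]=)
open import Data.Fin as Fin using (Fin; zero; suc)
open import Data.Fin.Subset using (Subset; _⊆_; _∈_; _∉_; ⊥; ⁅_⁆; _∪_; _─_; ∣_∣)
open import Data.Fin.Subset.Properties
  using (_∈?_; _⊆?_; ⊆-antisym; ⊆-trans; ⊥⊆; x∈⁅x⁆; x∈⁅y⁆⇒x≡y; x∈p∪q⁻; p⊆p∪q;
         q⊆p∪q; x∈p∧x∉q⇒x∈p─q; x∈p∧x≢y⇒x∈p-y; p─q⊆p; p⊆q⇒∣p∣≤∣q∣; ∣⊥∣≡0; ∣⁅x⁆∣≡1;
         ∪-identityˡ; Empty-unique; p─⊥≡p; drop-∷-⊆)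
open import Data.List using (List; []; _∷_; _++_; map; foldr; allFin; applyUpTo; upTo)
open import Data.List.Membership.Propositional using (lose) renaming (_∈_ to _∈ˡ_)
open import Data.List.Membership.Propositional.Properties using (∈-map⁺; ∈-++⁺ˡ; ∈-++⁺ʳ; ∈-allFin)
open import Data.List.Relation.Unary.Any using (here; there; satisfied)
open import Data.List.Relation.Unary.Any.Properties using (any⁺; any⁻)
open import Data.Bool.ListAction using (all; any)
open import Data.Product using (∃; _×_; _,_; proj₁; proj₂)
open import Data.Sum using (_⊎_; inj₁; inj₂)
open import Data.Empty using (⊥-elim) renaming (⊥ to False)
open import Data.Unit using (tt)
open import Function using (_∘_)
open import Relation.Nullary using (¬_; Dec; yes; no)
open import Relation.Nullary.Decidable using (decidable-stable)
open import Relation.Binary.PropositionalEquality as ≡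
  using (_≡_; _≢_; refl; cong; cong₂; subst; subst₂)
import Relation.Binary.Reasoning.Setoid as SetoidReasoning

private variable n : ℕ

module Matroids where
  open import Data.Nat using (_+_)

  T-∧ˡ : ∀ {x y} → T (x ∧ y) → T x
  T-∧ˡ {true} _ = tt

  T-∧ʳ : ∀ {x y} → T (x ∧ y) → T y
  T-∧ʳ {true} t = t

  T-∧⁺ : ∀ {x y} → T x → T y → T (x ∧ y)
  T-∧⁺ {true} _ t = t

  T⇒≡true : ∀ {x} → T x → x ≡ true
  T⇒≡true {true} _ = refl

  T-not : ∀ {x} → T (not x) → ¬ T x
  T-not {false} _ ()

  ¬T⇒≡false : ∀ {x} → ¬ T x → x ≡ false
  ¬T⇒≡false {false} _ = refl
  ¬T⇒≡false {true}  h = ⊥-elim (h tt)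

  all-sound : ∀ {a} {A : Set a} (f : A → Bool) xs → T (all f xs) → ∀ {x} → x ∈ˡ xs → T (f x)
  all-sound f (y ∷ xs) t (here refl) = T-∧ˡ {f y} t
  all-sound f (y ∷ xs) t (there x∈) = all-sound f xs (T-∧ʳ {f y} t) x∈

  all-complete : ∀ {a} {A : Set a} (f : A → Bool) xs → (∀ {x} → x ∈ˡ xs → T (f x)) → T (all f xs)
  all-complete f []       h = tt
  all-complete f (y ∷ xs) h = T-∧⁺ {f y} (h (here refl)) (all-complete f xs (λ x∈ → h (there x∈)))

  all-at : ∀ {a} {A : Set a} (f : A → Bool) xs {x} → x ∈ˡ xs →
           (∀ y → y ≡ x ⊎ T (f y)) → all f xs ≡ f x
  all-at f xs {x} x∈ others with f x in fx
  ... | true  = T⇒≡true (all-complete f xs λ {y} _ → passes y (others y))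
    where passes : ∀ y → y ≡ x ⊎ T (f y) → T (f y)
          passes y (inj₁ refl) = subst T (≡.sym fx) tt
          passes y (inj₂ t)    = t
  ... | false = ¬T⇒≡false λ t → subst T fx (all-sound f xs t x∈)

  any-sound : ∀ {a} {A : Set a} (f : A → Bool) xs → T (any f xs) → ∃ λ x → T (f x)
  any-sound f xs t = satisfied (any⁻ f xs t)

  any-complete : ∀ {a} {A : Set a} (f : A → Bool) xs {x} → x ∈ˡ xs → T (f x) → T (any f xs)
  any-complete f xs x∈ t = any⁺ f (lose x∈ t)

  allSubsets-complete : ∀ n (p : Subset n) → p ∈ˡ allSubsets n
  allSubsets-complete zero    []          = here refl
  allSubsets-complete (suc n) (true ∷ p)  = ∈-++⁺ˡ (∈-map⁺ (true ∷_) (allSubsets-complete n p))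
  allSubsets-complete (suc n) (false ∷ p) =
    ∈-++⁺ʳ (map (true ∷_) (allSubsets n)) (∈-map⁺ (false ∷_) (allSubsets-complete n p))

  ⊆ᵇ⇒⊆ : {p q : Subset n} → T (p ⊆ᵇ q) → p ⊆ q
  ⊆ᵇ⇒⊆ {p = true ∷ p} {true ∷ q} t here      = here
  ⊆ᵇ⇒⊆ {p = x ∷ p}    {y ∷ q}    t (there i) = there (⊆ᵇ⇒⊆ (T-∧ʳ {not x ∨ y} t) i)

  ⊆⇒⊆ᵇ : {p q : Subset n} → p ⊆ q → T (p ⊆ᵇ q)
  ⊆⇒⊆ᵇ {p = []}        {[]}        _   = tt
  ⊆⇒⊆ᵇ {p = false ∷ p} {_ ∷ q}     p⊆q = ⊆⇒⊆ᵇ (drop-∷-⊆ p⊆q)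
  ⊆⇒⊆ᵇ {p = true ∷ p}  {true ∷ q}  p⊆q = ⊆⇒⊆ᵇ (drop-∷-⊆ p⊆q)
  ⊆⇒⊆ᵇ {p = true ∷ p}  {false ∷ q} p⊆q with p⊆q here
  ... | ()

  x∈p─q⁻ : ∀ {x : Fin n} (p q : Subset n) → x ∈ p ─ q → x ∈ p × x ∉ q
  x∈p─q⁻ p q x∈ = p─q⊆p p q x∈ , x∉q p q x∈
    where x∉q : ∀ {n} {x : Fin n} (p q : Subset n) → x ∈ p ─ q → x ∉ q
          x∉q (_ ∷ p) (true ∷ q)  (there x∈) (there x∈q) = x∉q p q x∈ x∈q
          x∉q (_ ∷ p) (false ∷ q) (there x∈) (there x∈q) = x∉q p q x∈ x∈q

  ──-cancel : (E A : Subset n) → A ⊆ E → E ─ (E ─ A) ≡ A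
  ──-cancel E A A⊆E = ⊆-antisym in-A in-E─E─A
    where
      in-A : E ─ (E ─ A) ⊆ A
      in-A {x} x∈ = decidable-stable (x ∈? A) λ x∉A →
        proj₂ (x∈p─q⁻ E (E ─ A) x∈) (x∈p∧x∉q⇒x∈p─q (proj₁ (x∈p─q⁻ E (E ─ A) x∈)) x∉A)
      in-E─E─A : A ⊆ E ─ (E ─ A)
      in-E─E─A x∈A = x∈p∧x∉q⇒x∈p─q (A⊆E x∈A) λ x∈E─A → proj₂ (x∈p─q⁻ E A x∈E─A) x∈A

  ∪-⊆ : {p q r : Subset n} → p ⊆ r → q ⊆ r → p ∪ q ⊆ r
  ∪-⊆ {p = p} {q} p⊆r q⊆r x∈ with x∈p∪q⁻ p q x∈
  ... | inj₁ x∈p = p⊆r x∈p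
  ... | inj₂ x∈q = q⊆r x∈q

  ⁅⁆-⊆ : {x : Fin n} {p : Subset n} → x ∈ p → ⁅ x ⁆ ⊆ p
  ⁅⁆-⊆ {x = x} x∈p y∈ rewrite x∈⁅y⁆⇒x≡y x y∈ = x∈p

  ∣p∪q∣ : (p q : Subset n) → (∀ {x} → x ∈ p → x ∉ q) → ∣ p ∪ q ∣ ≡ ∣ p ∣ + ∣ q ∣
  ∣p∪q∣ []          []          _ = refl
  ∣p∪q∣ (true ∷ p)  (true ∷ q)  disj = ⊥-elim (disj here here)
  ∣p∪q∣ (true ∷ p)  (false ∷ q) disj = cong suc (∣p∪q∣ p q λ x∈p x∈q → disj (there x∈p) (there x∈q))
  ∣p∪q∣ (false ∷ p) (true ∷ q)  disj = ≡.trans (cong suc (∣p∪q∣ p q λ x∈p x∈q → disj (there x∈p) (there x∈q)))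
                                               (≡.sym (+-suc ∣ p ∣ ∣ q ∣))
  ∣p∪q∣ (false ∷ p) (false ∷ q) disj = ∣p∪q∣ p q λ x∈p x∈q → disj (there x∈p) (there x∈q)

  ∣p∪⁅x⁆∣ : (p : Subset n) (x : Fin n) → x ∉ p → ∣ p ∪ ⁅ x ⁆ ∣ ≡ suc ∣ p ∣
  ∣p∪⁅x⁆∣ p x x∉p = begin
    ∣ p ∪ ⁅ x ⁆ ∣     ≡⟨ ∣p∪q∣ p ⁅ x ⁆ (λ y∈p y∈⁅x⁆ → x∉p (subst (_∈ p) (x∈⁅y⁆⇒x≡y x y∈⁅x⁆) y∈p)) ⟩
    ∣ p ∣ + ∣ ⁅ x ⁆ ∣ ≡⟨ cong (∣ p ∣ +_) (∣⁅x⁆∣≡1 x) ⟩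
    ∣ p ∣ + 1         ≡⟨ ℕₚ.+-comm ∣ p ∣ 1 ⟩
    suc ∣ p ∣         ∎
    where open ≡.≡-Reasoning

  ∣p─⁅x⁆∣ : (p : Subset n) (x : Fin n) → x ∈ p → suc ∣ p ─ ⁅ x ⁆ ∣ ≡ ∣ p ∣
  ∣p─⁅x⁆∣ (true ∷ p)  zero    here      = cong (λ q → suc ∣ q ∣) (p─⊥≡p p)
  ∣p─⁅x⁆∣ (true ∷ p)  (suc x) (there i) = cong suc (∣p─⁅x⁆∣ p x i)
  ∣p─⁅x⁆∣ (false ∷ p) (suc x) (there i) = ∣p─⁅x⁆∣ p x i

  ∣p∣<∣q∣ : {p q : Subset n} {x : Fin n} → p ⊆ q → x ∈ q → x ∉ p → ∣ p ∣ < ∣ q ∣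
  ∣p∣<∣q∣ {p = p} {q} {x} p⊆q x∈q x∉p =
    subst (_≤ ∣ q ∣) (∣p∪⁅x⁆∣ p x x∉p) (p⊆q⇒∣p∣≤∣q∣ (∪-⊆ p⊆q (⁅⁆-⊆ x∈q)))

  ∣p∣≡0⇒p≡⊥ : (p : Subset n) → ∣ p ∣ ≡ 0 → p ≡ ⊥
  ∣p∣≡0⇒p≡⊥ []          _   = refl
  ∣p∣≡0⇒p≡⊥ (false ∷ p) ∣p∣≡0 = cong (false ∷_) (∣p∣≡0⇒p≡⊥ p ∣p∣≡0)

  ⊆⁅x⁆ : (x : Fin n) (p : Subset n) → p ⊆ ⁅ x ⁆ → p ≡ ⊥ ⊎ p ≡ ⁅ x ⁆
  ⊆⁅x⁆ x p p⊆ with x ∈? p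
  ... | yes x∈p = inj₂ (⊆-antisym p⊆ (⁅⁆-⊆ x∈p))
  ... | no  x∉p = inj₁ (Empty-unique λ { (y , y∈p) → x∉p (subst (_∈ p) (x∈⁅y⁆⇒x≡y x (p⊆ y∈p)) y∈p) })

  module _ {a} {A : Set a} (P : A → Bool) (g : A → ℕ) where

    maxOver : List A → ℕ
    maxOver = foldr (λ S m → if P S then g S ⊔ m else m) 0

    maxOver-upper : ∀ L {S} → S ∈ˡ L → T (P S) → g S ≤ maxOver L
    maxOver-upper (y ∷ L) (here refl) t with P y
    ... | true = m≤m⊔n (g y) _
    maxOver-upper (y ∷ L) (there S∈) t with P y
    ... | true  = ≤-trans (maxOver-upper L S∈ t) (m≤n⊔m (g y) _)
    ... | false = maxOver-upper L S∈ t

    maxOver-attained : ∀ L → maxOver L ≡ 0 ⊎ ∃ λ S → T (P S) × g S ≡ maxOver L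
    maxOver-attained []      = inj₁ refl
    maxOver-attained (y ∷ L) with P y in Py
    ... | false = maxOver-attained L
    ... | true with maxOver-attained L | ⊔-sel (g y) (maxOver L)
    ...   | inj₁ max≡0         | _         rewrite max≡0 | ⊔-identityʳ (g y) =
            inj₂ (y , subst T (≡.sym Py) tt , refl)
    ...   | inj₂ _             | inj₁ left  = inj₂ (y , subst T (≡.sym Py) tt , ≡.sym left)
    ...   | inj₂ (S , PS , gS) | inj₂ right = inj₂ (S , PS , ≡.trans gS (≡.sym right))

  IsRankOf : SetSystem n → Subset n → ℕ → Set
  IsRankOf M A m = (∀ S → T (indep M S) → S ⊆ A → ∣ S ∣ ≤ m)
                 × (∃ λ S → T (indep M S) × S ⊆ A × ∣ S ∣ ≡ m)

  rankOf-isRankOf : (M : SetSystem n) (A : Subset n) → T (indep M ⊥) → IsRankOf M A (rankOf M A)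
  rankOf-isRankOf {n} M A ∅-indep = upper , attained
    where
      P : Subset n → Bool
      P S = indep M S ∧ (S ⊆ᵇ A)
      upper : ∀ S → T (indep M S) → S ⊆ A → ∣ S ∣ ≤ rankOf M A
      upper S S-indep S⊆A = maxOver-upper P ∣_∣ (allSubsets n) (allSubsets-complete n S)
                              (T-∧⁺ {indep M S} S-indep (⊆⇒⊆ᵇ S⊆A))
      attained : ∃ λ S → T (indep M S) × S ⊆ A × ∣ S ∣ ≡ rankOf M A
      attained with maxOver-attained P ∣_∣ (allSubsets n)
      ... | inj₁ rank≡0      = ⊥ , ∅-indep , ⊥⊆ , ≡.trans (∣⊥∣≡0 n) (≡.sym rank≡0)
      ... | inj₂ (S , PS , ∣S∣≡) = S , T-∧ˡ {indep M S} PS , ⊆ᵇ⇒⊆ (T-∧ʳ {indep M S} PS) , ∣S∣≡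

  IsRankOf-unique : {M : SetSystem n} {A : Subset n} {m m′ : ℕ} →
                    IsRankOf M A m → IsRankOf M A m′ → m ≡ m′
  IsRankOf-unique (upper , (S , S-indep , S⊆A , ∣S∣≡m)) (upper′ , (S′ , S′-indep , S′⊆A , ∣S′∣≡m′)) =
    ≤-antisym (subst (_≤ _) ∣S∣≡m (upper′ S S-indep S⊆A)) (subst (_≤ _) ∣S′∣≡m′ (upper S′ S′-indep S′⊆A))

  module _ (S : SetSystem n) where

    IsMaximal : Subset n → Set
    IsMaximal B = T (indep S B) × (∀ x → x ∈ ground S → x ∉ B → ¬ T (indep S (B ∪ ⁅ x ⁆)))

    isBasis-sound : ∀ B → T (isBasis S B) → IsMaximal B
    isBasis-sound B t = T-∧ˡ {indep S B} t , blocked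
      where
        blocked : ∀ x → x ∈ ground S → x ∉ B → ¬ T (indep S (B ∪ ⁅ x ⁆))
        blocked x x∈E x∉B = T-not
          (subst (λ x∈? → T (not x∈? ∨ not (indep S (B ∪ ⁅ x ⁆))))
                 ([]=⇒lookup (x∈p∧x∉q⇒x∈p─q x∈E x∉B))
                 (all-sound _ (allFin n) (T-∧ʳ {indep S B} t) (∈-allFin x)))

    isBasis-complete : ∀ B → IsMaximal B → T (isBasis S B)
    isBasis-complete B (B-indep , blocked) =
      T-∧⁺ {indep S B} B-indep (all-complete _ (allFin n) λ {x} _ → test x)
      where
        test : ∀ x → T (not (lookup (ground S ─ B) x) ∨ not (indep S (B ∪ ⁅ x ⁆)))
        test x with lookup (ground S ─ B) x in x∈?
        ... | false = tt
        ... | true with x∈p─q⁻ (ground S) B (lookup⇒[]= x _ x∈?) | indep S (B ∪ ⁅ x ⁆) in Bx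
        ...   | x∈E , x∉B | true  = blocked x x∈E x∉B (subst T (≡.sym Bx) tt)
        ...   | _         | false = tt

    maximal-⊇ : (∀ I J → J ⊆ I → T (indep S I) → T (indep S J)) →
                ∀ {X Y} → IsMaximal X → T (indep S Y) → X ⊆ Y → Y ⊆ ground S → Y ⊆ X
    maximal-⊇ hereditary {X} {Y} (_ , blocked) Y-indep X⊆Y Y⊆E {y} y∈Y =
      decidable-stable (y ∈? X) λ y∉X →
        blocked y (Y⊆E y∈Y) y∉X (hereditary Y (X ∪ ⁅ y ⁆) (∪-⊆ X⊆Y (⁅⁆-⊆ y∈Y)) Y-indep)

  module MatroidFacts {n} (M : SetSystem n) (isM : IsMatroid M) where
    open IsMatroid isM

    rank-isRankOf : IsRankOf M (ground M) (rank M)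
    rank-isRankOf = rankOf-isRankOf M (ground M) indep-∅

    indep≤rank : ∀ S → T (indep M S) → ∣ S ∣ ≤ rank M
    indep≤rank S S-indep = proj₁ rank-isRankOf S S-indep (indep⊆ground S S-indep)

    rank≤∣ground∣ : rank M ≤ ∣ ground M ∣
    rank≤∣ground∣ with proj₂ rank-isRankOf
    ... | S , _ , S⊆E , ∣S∣≡r = subst (_≤ ∣ ground M ∣) ∣S∣≡r (p⊆q⇒∣p∣≤∣q∣ S⊆E)

    IsBase : Subset n → Set
    IsBase B = T (indep M B) × ∣ B ∣ ≡ rank M

    some-base : ∃ IsBase
    some-base with proj₂ rank-isRankOf
    ... | S , S-indep , _ , ∣S∣≡r = S , S-indep , ∣S∣≡r

    grow : ∀ k I S → T (indep M I) → T (indep M S) → ∣ I ∣ + k ≡ ∣ S ∣ →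
           ∃ λ I′ → T (indep M I′) × I ⊆ I′ × I′ ⊆ I ∪ S × ∣ I′ ∣ ≡ ∣ S ∣
    grow zero    I S I-indep _ ∣I∣≡ =
      I , I-indep , (λ x∈ → x∈) , p⊆p∪q S , ≡.trans (≡.sym (ℕₚ.+-identityʳ _)) ∣I∣≡
    grow (suc k) I S I-indep S-indep ∣I∣+k+1≡
      with augmentation I S I-indep S-indep (≤-trans (m≤m+n (suc ∣ I ∣) k) (≤-reflexive ∣I∣+1+k≡))
      where ∣I∣+1+k≡ : suc ∣ I ∣ + k ≡ ∣ S ∣
            ∣I∣+1+k≡ = ≡.trans (≡.sym (+-suc ∣ I ∣ k)) ∣I∣+k+1≡
    ... | x , x∈S , x∉I , Ix-indep
      with grow k (I ∪ ⁅ x ⁆) S Ix-indep S-indep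
                  (≡.trans (cong (_+ k) (∣p∪⁅x⁆∣ I x x∉I)) (≡.trans (≡.sym (+-suc ∣ I ∣ k)) ∣I∣+k+1≡))
    ...   | I′ , I′-indep , Ix⊆I′ , I′⊆IxS , ∣I′∣≡ =
            I′ , I′-indep , ⊆-trans (p⊆p∪q ⁅ x ⁆) Ix⊆I′ ,
            ⊆-trans I′⊆IxS (∪-⊆ (∪-⊆ (p⊆p∪q S) (⁅⁆-⊆ (q⊆p∪q I S x∈S))) (q⊆p∪q I S)) , ∣I′∣≡

    extend-to-base : ∀ I B → T (indep M I) → IsBase B → ∃ λ B′ → IsBase B′ × I ⊆ B′ × B′ ⊆ I ∪ B
    extend-to-base I B I-indep (B-indep , ∣B∣≡r)
      with grow (∣ B ∣ ∸ ∣ I ∣) I B I-indep B-indep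
                (m+[n∸m]≡n (subst (∣ I ∣ ≤_) (≡.sym ∣B∣≡r) (indep≤rank I I-indep)))
    ... | B′ , B′-indep , I⊆B′ , B′⊆IB , ∣B′∣≡ = B′ , (B′-indep , ≡.trans ∣B′∣≡ ∣B∣≡r) , I⊆B′ , B′⊆IB

    base-⊄ : ∀ {B B′ x} → IsBase B → IsBase B′ → B ⊆ B′ → x ∈ B′ → x ∉ B → False
    base-⊄ (_ , ∣B∣≡r) (_ , ∣B′∣≡r) B⊆B′ x∈B′ x∉B =
      n≮n (rank M) (subst₂ _<_ ∣B∣≡r ∣B′∣≡r (∣p∣<∣q∣ B⊆B′ x∈B′ x∉B))

    maximal⇒base : ∀ B → IsMaximal M B → IsBase B
    maximal⇒base B (B-indep , blocked) with m≤n⇒m<n∨m≡n (indep≤rank B B-indep)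
    ... | inj₂ ∣B∣≡r = B-indep , ∣B∣≡r
    ... | inj₁ ∣B∣<r with some-base
    ...   | S , S-indep , ∣S∣≡r with augmentation B S B-indep S-indep (subst (∣ B ∣ <_) (≡.sym ∣S∣≡r) ∣B∣<r)
    ...     | x , x∈S , x∉B , Bx-indep = ⊥-elim (blocked x (indep⊆ground S S-indep x∈S) x∉B Bx-indep)

    base⇒maximal : ∀ B → IsBase B → IsMaximal M B
    base⇒maximal B (B-indep , ∣B∣≡r) = B-indep , λ x _ x∉B Bx-indep →
      n≮n (rank M) (subst (_≤ rank M) (≡.trans (∣p∪⁅x⁆∣ B x x∉B) (cong suc ∣B∣≡r))
                          (indep≤rank _ Bx-indep))

    dual-indep⁻ : ∀ I → T (indep (dual M) I) → ∃ λ B → IsBase B × I ⊆ ground M ─ B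
    dual-indep⁻ I t with any-sound _ (allSubsets n) t
    ... | B , B-test = B , maximal⇒base B (isBasis-sound M B (T-∧ˡ {isBasis M B} B-test)) ,
                       ⊆ᵇ⇒⊆ (T-∧ʳ {isBasis M B} B-test)

    dual-indep⁺ : ∀ I B → IsBase B → I ⊆ ground M ─ B → T (indep (dual M) I)
    dual-indep⁺ I B B-base I⊆ = any-complete _ (allSubsets n) (allSubsets-complete n B)
      (T-∧⁺ {isBasis M B} (isBasis-complete M B (base⇒maximal B B-base)) (⊆⇒⊆ᵇ I⊆))

  -- Let Z = {e} if e is not a loop and Z = ∅ if it
  -- is; in both cases Z ⊆ {e}, Z is independent, and every independent set containing e has
  -- e ∈ Z.  Under these hypotheses the independent sets of M/e = (M* \ e)* are exactly the
  -- I ⊆ E - e with I ∪ Z independent in M; so M/e is a matroid of rank r(M) - |Z|.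

  module SingleContraction {n} (M : SetSystem n) (isM : IsMatroid M) (e : Fin n)
    (Z : Subset n) (Z⊆⁅e⁆ : Z ⊆ ⁅ e ⁆) (Z-indep : T (indep M Z))
    (e∈Z : ∀ S → T (indep M S) → e ∈ S → e ∈ Z) where

    open IsMatroid isM
    open MatroidFacts M isM

    E-e : Subset n
    E-e = ground M ─ ⁅ e ⁆

    D : SetSystem n
    D = delete (dual M) ⁅ e ⁆

    C : SetSystem n
    C = contract M ⁅ e ⁆

    E-e⊆E : E-e ⊆ ground M
    E-e⊆E = p─q⊆p (ground M) ⁅ e ⁆

    ∉Z : ∀ {x} → x ∈ E-e → x ∉ Z
    ∉Z x∈E-e x∈Z = proj₂ (x∈p─q⁻ (ground M) ⁅ e ⁆ x∈E-e) (Z⊆⁅e⁆ x∈Z)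

    D-indep⁻ : ∀ X → T (indep D X) → (∃ λ B → IsBase B × X ⊆ ground M ─ B) × X ⊆ E-e
    D-indep⁻ X t = dual-indep⁻ X (T-∧ˡ {indep (dual M) X} t) , ⊆ᵇ⇒⊆ (T-∧ʳ {indep (dual M) X} t)

    D-indep⁺ : ∀ X B → IsBase B → X ⊆ ground M ─ B → X ⊆ E-e → T (indep D X)
    D-indep⁺ X B B-base X⊆E─B X⊆E-e = T-∧⁺ {indep (dual M) X} (dual-indep⁺ X B B-base X⊆E─B) (⊆⇒⊆ᵇ X⊆E-e)

    D-hereditary : ∀ I J → J ⊆ I → T (indep D I) → T (indep D J)
    D-hereditary I J J⊆I t with D-indep⁻ I t
    ... | (B , B-base , I⊆E─B) , I⊆E-e = D-indep⁺ J B B-base (⊆-trans J⊆I I⊆E─B) (⊆-trans J⊆I I⊆E-e)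

    complement-indep : ∀ T₁ → IsBase T₁ → T (indep D (E-e ─ T₁))
    complement-indep T₁ T₁-base = D-indep⁺ (E-e ─ T₁) T₁ T₁-base E-e─T₁⊆E─T₁ (p─q⊆p E-e T₁)
      where E-e─T₁⊆E─T₁ : E-e ─ T₁ ⊆ ground M ─ T₁
            E-e─T₁⊆E─T₁ x∈ with x∈p─q⁻ E-e T₁ x∈
            ... | x∈E-e , x∉T₁ = x∈p∧x∉q⇒x∈p─q (E-e⊆E x∈E-e) x∉T₁

    complement-maximal : ∀ T₁ → IsBase T₁ → Z ⊆ T₁ → IsMaximal D (E-e ─ T₁)
    complement-maximal T₁ T₁-base Z⊆T₁ = complement-indep T₁ T₁-base , blocked
      where
        blocked : ∀ x → x ∈ E-e → x ∉ E-e ─ T₁ → ¬ T (indep D ((E-e ─ T₁) ∪ ⁅ x ⁆))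
        blocked x x∈E-e x∉X t with D-indep⁻ _ t
        ... | (B′ , B′-base , X∪x⊆E─B′) , _ = base-⊄ B′-base T₁-base B′⊆T₁ x∈T₁ x∉B′
          where
            x∈T₁ : x ∈ T₁
            x∈T₁ = decidable-stable (x ∈? T₁) λ x∉T₁ → x∉X (x∈p∧x∉q⇒x∈p─q x∈E-e x∉T₁)
            ∉B′ : ∀ {y} → y ∈ (E-e ─ T₁) ∪ ⁅ x ⁆ → y ∉ B′
            ∉B′ y∈ = proj₂ (x∈p─q⁻ (ground M) B′ (X∪x⊆E─B′ y∈))
            x∉B′ : x ∉ B′
            x∉B′ = ∉B′ (q⊆p∪q (E-e ─ T₁) ⁅ x ⁆ (x∈⁅x⁆ x))
            B′⊆T₁ : B′ ⊆ T₁
            B′⊆T₁ {y} y∈B′ = decidable-stable (y ∈? T₁) λ y∉T₁ → whether-e (y Fin.≟ e) y∉T₁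
              where
                -- y = e is excluded because e ∈ B′ forces e ∈ Z ⊆ T₁; any other y would lie in X
                whether-e : Dec (y ≡ e) → y ∉ T₁ → False
                whether-e (yes refl) y∉T₁ = y∉T₁ (Z⊆T₁ (e∈Z B′ (proj₁ B′-base) y∈B′))
                whether-e (no y≢e)   y∉T₁ = ∉B′ (p⊆p∪q ⁅ x ⁆ (x∈p∧x∉q⇒x∈p─q y∈E-e y∉T₁)) y∈B′
                  where y∈E-e : y ∈ E-e
                        y∈E-e = x∈p∧x≢y⇒x∈p-y (indep⊆ground B′ (proj₁ B′-base) y∈B′) y≢e

    maximal-complement : ∀ X → IsMaximal D X →
      ∃ λ T₁ → IsBase T₁ × Z ⊆ T₁ × (∀ {x} → x ∈ E-e → x ∉ X → x ∈ T₁)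
    maximal-complement X X-max with D-indep⁻ X (proj₁ X-max)
    ... | (B , B-base , X⊆E─B) , X⊆E-e with extend-to-base Z B Z-indep B-base
    ...   | T₁ , T₁-base , Z⊆T₁ , T₁⊆Z∪B = T₁ , T₁-base , Z⊆T₁ , omitted⊆T₁
      where
        X⊆E-e─T₁ : X ⊆ E-e ─ T₁
        X⊆E-e─T₁ {x} x∈X = x∈p∧x∉q⇒x∈p─q (X⊆E-e x∈X) λ x∈T₁ → neither (x∈p∪q⁻ Z B (T₁⊆Z∪B x∈T₁))
          where neither : x ∈ Z ⊎ x ∈ B → False
                neither (inj₁ x∈Z) = ∉Z (X⊆E-e x∈X) x∈Z
                neither (inj₂ x∈B) = proj₂ (x∈p─q⁻ (ground M) B (X⊆E─B x∈X)) x∈B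
        E-e─T₁⊆X : E-e ─ T₁ ⊆ X
        E-e─T₁⊆X = maximal-⊇ D D-hereditary X-max (complement-indep T₁ T₁-base) X⊆E-e─T₁ (p─q⊆p E-e T₁)
        omitted⊆T₁ : ∀ {x} → x ∈ E-e → x ∉ X → x ∈ T₁
        omitted⊆T₁ {x} x∈E-e x∉X =
          decidable-stable (x ∈? T₁) λ x∉T₁ → x∉X (E-e─T₁⊆X (x∈p∧x∉q⇒x∈p─q x∈E-e x∉T₁))

    contract-indep⁻ : ∀ I → T (indep C I) → I ⊆ E-e × T (indep M (I ∪ Z))
    contract-indep⁻ I t with any-sound (λ X → isBasis D X ∧ (I ⊆ᵇ (E-e ─ X))) (allSubsets n) t
    ... | X , X-test = via-base (maximal-complement X (isBasis-sound D X (T-∧ˡ {isBasis D X} X-test)))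
      where
        I⊆E-e─X : I ⊆ E-e ─ X
        I⊆E-e─X = ⊆ᵇ⇒⊆ (T-∧ʳ {isBasis D X} X-test)
        I⊆E-e : I ⊆ E-e
        I⊆E-e = ⊆-trans I⊆E-e─X (p─q⊆p E-e X)
        via-base : (∃ λ T₁ → IsBase T₁ × Z ⊆ T₁ × (∀ {x} → x ∈ E-e → x ∉ X → x ∈ T₁)) →
                   I ⊆ E-e × T (indep M (I ∪ Z))
        via-base (T₁ , T₁-base , Z⊆T₁ , omitted⊆T₁) =
          I⊆E-e , hereditary T₁ (I ∪ Z) (∪-⊆ I⊆T₁ Z⊆T₁) (proj₁ T₁-base)
          where I⊆T₁ : I ⊆ T₁
                I⊆T₁ i∈I = omitted⊆T₁ (I⊆E-e i∈I) (proj₂ (x∈p─q⁻ E-e X (I⊆E-e─X i∈I)))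

    contract-indep⁺ : ∀ I → I ⊆ E-e → T (indep M (I ∪ Z)) → T (indep C I)
    contract-indep⁺ I I⊆E-e IZ-indep with extend-to-base (I ∪ Z) (proj₁ some-base) IZ-indep (proj₂ some-base)
    ... | T₁ , T₁-base , IZ⊆T₁ , _ =
      any-complete (λ X → isBasis D X ∧ (I ⊆ᵇ (E-e ─ X))) (allSubsets n) (allSubsets-complete n (E-e ─ T₁))
        (T-∧⁺ {isBasis D (E-e ─ T₁)}
          (isBasis-complete D (E-e ─ T₁) (complement-maximal T₁ T₁-base (⊆-trans (q⊆p∪q I Z) IZ⊆T₁)))
          (⊆⇒⊆ᵇ I⊆E-e─X))
      where
        I⊆E-e─X : I ⊆ E-e ─ (E-e ─ T₁)
        I⊆E-e─X i∈I = x∈p∧x∉q⇒x∈p─q (I⊆E-e i∈I)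
                        λ i∈X → proj₂ (x∈p─q⁻ E-e T₁ i∈X) (IZ⊆T₁ (p⊆p∪q Z i∈I))

    private
      ∣I∪Z∣ : ∀ I → I ⊆ E-e → ∣ I ∪ Z ∣ ≡ ∣ I ∣ + ∣ Z ∣
      ∣I∪Z∣ I I⊆E-e = ∣p∪q∣ I Z (λ x∈I → ∉Z (I⊆E-e x∈I))

      -- augmentation in M/e comes from augmentation of I ∪ Z by J ∪ Z in M
      augment : ∀ I J → I ⊆ E-e → J ⊆ E-e → T (indep M (I ∪ Z)) → T (indep M (J ∪ Z)) →
                ∣ I ∣ < ∣ J ∣ → ∃ λ x → x ∈ J × x ∉ I × T (indep C (I ∪ ⁅ x ⁆))
      augment I J I⊆E-e J⊆E-e IZ-indep JZ-indep ∣I∣<∣J∣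
        with augmentation (I ∪ Z) (J ∪ Z) IZ-indep JZ-indep
               (subst₂ _<_ (≡.sym (∣I∪Z∣ I I⊆E-e)) (≡.sym (∣I∪Z∣ J J⊆E-e)) (+-monoˡ-< ∣ Z ∣ ∣I∣<∣J∣))
      ... | x , x∈J∪Z , x∉I∪Z , IZx-indep = x , x∈J , x∉I∪Z ∘ p⊆p∪q Z , Ix-indep
        where
          x∈J : x ∈ J
          x∈J with x∈p∪q⁻ J Z x∈J∪Z
          ... | inj₁ x∈J = x∈J
          ... | inj₂ x∈Z = ⊥-elim (x∉I∪Z (q⊆p∪q I Z x∈Z))
          IxZ⊆IZx : (I ∪ ⁅ x ⁆) ∪ Z ⊆ (I ∪ Z) ∪ ⁅ x ⁆
          IxZ⊆IZx = ∪-⊆ (∪-⊆ (⊆-trans (p⊆p∪q Z) (p⊆p∪q ⁅ x ⁆)) (q⊆p∪q (I ∪ Z) ⁅ x ⁆))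
                        (⊆-trans (q⊆p∪q I Z) (p⊆p∪q ⁅ x ⁆))
          Ix-indep : T (indep C (I ∪ ⁅ x ⁆))
          Ix-indep = contract-indep⁺ (I ∪ ⁅ x ⁆) (∪-⊆ I⊆E-e (⁅⁆-⊆ (J⊆E-e x∈J)))
                       (hereditary _ _ IxZ⊆IZx IZx-indep)

    contract-isMatroid : IsMatroid C
    contract-isMatroid = record
      { indep⊆ground = λ I t → proj₁ (contract-indep⁻ I t)
      ; indep-∅      = contract-indep⁺ ⊥ ⊥⊆ (subst (λ S → T (indep M S)) (≡.sym (∪-identityˡ Z)) Z-indep)
      ; hereditary   = λ I J J⊆I t →
          contract-indep⁺ J (⊆-trans J⊆I (proj₁ (contract-indep⁻ I t)))
            (hereditary (I ∪ Z) (J ∪ Z) (∪-⊆ (⊆-trans J⊆I (p⊆p∪q Z)) (q⊆p∪q I Z)) (proj₂ (contract-indep⁻ I t)))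
      ; augmentation = λ I J tI tJ → augment I J (proj₁ (contract-indep⁻ I tI)) (proj₁ (contract-indep⁻ J tJ))
                                                (proj₂ (contract-indep⁻ I tI)) (proj₂ (contract-indep⁻ J tJ))
      }

    -- r(M/e) = r(M) - |Z|: a base of M containing Z, minus Z, is a largest independent set of M/e
    contract-rank : rank C + ∣ Z ∣ ≡ rank M
    contract-rank = ≡.trans (cong (_+ ∣ Z ∣) rank≡) (m∸n+n≡m (indep≤rank Z Z-indep))
      where
        upper : ∀ S → T (indep C S) → S ⊆ E-e → ∣ S ∣ ≤ rank M ∸ ∣ Z ∣
        upper S t S⊆E-e = m+n≤o⇒m≤o∸n ∣ S ∣
          (subst (_≤ rank M) (∣I∪Z∣ S S⊆E-e) (indep≤rank (S ∪ Z) (proj₂ (contract-indep⁻ S t))))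
        attained : ∃ λ S → T (indep C S) × S ⊆ E-e × ∣ S ∣ ≡ rank M ∸ ∣ Z ∣
        attained with extend-to-base Z (proj₁ some-base) Z-indep (proj₂ some-base)
        ... | T₁ , (T₁-indep , ∣T₁∣≡r) , Z⊆T₁ , _ =
          S , contract-indep⁺ S S⊆E-e (subst (λ U → T (indep M U)) (≡.sym S∪Z≡T₁) T₁-indep) , S⊆E-e , ∣S∣≡
          where
            S : Subset n
            S = T₁ ─ Z
            S⊆E-e : S ⊆ E-e
            S⊆E-e {y} y∈S with x∈p─q⁻ T₁ Z y∈S
            ... | y∈T₁ , y∉Z = x∈p∧x≢y⇒x∈p-y (indep⊆ground T₁ T₁-indep y∈T₁)
                                 λ { refl → y∉Z (e∈Z T₁ T₁-indep y∈T₁) }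
            S∪Z≡T₁ : S ∪ Z ≡ T₁
            S∪Z≡T₁ = ⊆-antisym (∪-⊆ (p─q⊆p T₁ Z) Z⊆T₁) λ {y} y∈T₁ → whether-in-Z (y ∈? Z) y∈T₁
              where whether-in-Z : ∀ {y} → Dec (y ∈ Z) → y ∈ T₁ → y ∈ S ∪ Z
                    whether-in-Z (yes y∈Z) _    = q⊆p∪q S Z y∈Z
                    whether-in-Z (no y∉Z)  y∈T₁ = p⊆p∪q Z (x∈p∧x∉q⇒x∈p─q y∈T₁ y∉Z)
            ∣S∣≡ : ∣ S ∣ ≡ rank M ∸ ∣ Z ∣
            ∣S∣≡ = ≡.sym (begin
              rank M ∸ ∣ Z ∣        ≡⟨ cong (_∸ ∣ Z ∣) (≡.sym ∣T₁∣≡r) ⟩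
              ∣ T₁ ∣ ∸ ∣ Z ∣        ≡⟨ cong (λ U → ∣ U ∣ ∸ ∣ Z ∣) (≡.sym S∪Z≡T₁) ⟩
              ∣ S ∪ Z ∣ ∸ ∣ Z ∣     ≡⟨ cong (_∸ ∣ Z ∣) (∣I∪Z∣ S S⊆E-e) ⟩
              ∣ S ∣ + ∣ Z ∣ ∸ ∣ Z ∣ ≡⟨ m+n∸n≡m ∣ S ∣ ∣ Z ∣ ⟩
              ∣ S ∣                 ∎)
              where open ≡.≡-Reasoning
        rank≡ : rank C ≡ rank M ∸ ∣ Z ∣
        rank≡ = IsRankOf-unique {M = C}
                  (rankOf-isRankOf C E-e (IsMatroid.indep-∅ contract-isMatroid)) (upper , attained)

  module ContractElement {n} (M : SetSystem n) (isM : IsMatroid M) (e : Fin n) (e∈E : e ∈ ground M) where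
    open IsMatroid isM

    private
      module NonLoop (e-indep : T (indep M ⁅ e ⁆)) =
        SingleContraction M isM e ⁅ e ⁆ (λ x∈ → x∈) e-indep (λ _ _ _ → x∈⁅x⁆ e)
      module Loop (e-dep : ¬ T (indep M ⁅ e ⁆)) =
        SingleContraction M isM e ⊥ ⊥⊆ indep-∅
          (λ S S-indep e∈S → ⊥-elim (e-dep (hereditary S ⁅ e ⁆ (⁅⁆-⊆ e∈S) S-indep)))

      ∣E∣≡ : ∣ ground M ∣ ≡ suc ∣ ground M ─ ⁅ e ⁆ ∣
      ∣E∣≡ = ≡.sym (∣p─⁅x⁆∣ (ground M) e e∈E)

    C : SetSystem n
    C = contract M ⁅ e ⁆

    contract-isMatroid : IsMatroid C
    contract-isMatroid with indep M ⁅ e ⁆ in e-test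
    ... | true  = NonLoop.contract-isMatroid (subst T (≡.sym e-test) tt)
    ... | false = Loop.contract-isMatroid (subst T e-test)

    nonloop-contract : T (indep M ⁅ e ⁆) → rank M ≡ suc (rank C) × nullity M ≡ nullity C
    nonloop-contract e-indep = rank≡ , nullity≡
      where
        open NonLoop e-indep using (contract-rank)
        rank≡ : rank M ≡ suc (rank C)
        rank≡ = ≡.trans (≡.sym contract-rank) (≡.trans (cong (rank C +_) (∣⁅x⁆∣≡1 e)) (ℕₚ.+-comm (rank C) 1))
        nullity≡ : nullity M ≡ nullity C
        nullity≡ = cong₂ _∸_ ∣E∣≡ rank≡

    loop-contract : ¬ T (indep M ⁅ e ⁆) → rank M ≡ rank C × nullity M ≡ suc (nullity C)
    loop-contract e-dep = rank≡ , nullity≡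
      where
        open Loop e-dep using (contract-rank)
        open MatroidFacts C contract-isMatroid using (rank≤∣ground∣)
        rank≡ : rank M ≡ rank C
        rank≡ = ≡.trans (≡.sym contract-rank) (≡.trans (cong (rank C +_) (∣⊥∣≡0 n)) (ℕₚ.+-identityʳ (rank C)))
        nullity≡ : nullity M ≡ suc (nullity C)
        nullity≡ = ≡.trans (cong₂ _∸_ ∣E∣≡ rank≡) (+-∸-assoc 1 rank≤∣ground∣)

  restrict-≡ : (M : SetSystem n) (A : Subset n) → A ⊆ ground M →
               restrict M A ≡ mkSS A (λ I → indep M I ∧ (I ⊆ᵇ A))
  restrict-≡ M A A⊆E = cong (λ G → mkSS G (λ I → indep M I ∧ (I ⊆ᵇ G))) (──-cancel (ground M) A A⊆E)

  uniform-size : ∀ r (S : SetSystem n) → ∣ ground S ∣ ≢ 1 → isUniform r 1 S ≡ false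
  uniform-size r S ∣E∣≢1 with ∣ ground S ∣
  ... | zero        = refl
  ... | suc zero    = ⊥-elim (∣E∣≢1 refl)
  ... | suc (suc _) = refl

  ⊆ᵇ-refl : (p : Subset n) → (p ⊆ᵇ p) ≡ true
  ⊆ᵇ-refl p = T⇒≡true (⊆⇒⊆ᵇ {p = p} (λ x∈ → x∈))

  ⊥⊆ᵇ : (p : Subset n) → (⊥ ⊆ᵇ p) ≡ true
  ⊥⊆ᵇ p = T⇒≡true (⊆⇒⊆ᵇ {p = ⊥} {q = p} ⊥⊆)

  module SingleRestriction {n} (M : SetSystem n) (∅-indep : T (indep M ⊥)) (e : Fin n) where

    S : SetSystem n
    S = mkSS ⁅ e ⁆ (λ I → indep M I ∧ (I ⊆ᵇ ⁅ e ⁆))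

    -- the test that isUniform r 1 performs on each subset I
    test : ℕ → Subset n → Bool
    test r I = if indep S I then ((I ⊆ᵇ ⁅ e ⁆) ∧ (∣ I ∣ ≤ᵇ r)) else not ((I ⊆ᵇ ⁅ e ⁆) ∧ (∣ I ∣ ≤ᵇ r))

    passes-elsewhere : ∀ r I → I ≡ ⁅ e ⁆ ⊎ T (test r I)
    passes-elsewhere r I with I ⊆? ⁅ e ⁆
    ... | no I⊈ rewrite ¬T⇒≡false {I ⊆ᵇ ⁅ e ⁆} (I⊈ ∘ ⊆ᵇ⇒⊆) | ∧-zeroʳ (indep M I) = inj₂ tt
    ... | yes I⊆ with ⊆⁅x⁆ e I I⊆
    ...   | inj₂ I≡⁅e⁆ = inj₁ I≡⁅e⁆
    ...   | inj₁ refl rewrite T⇒≡true ∅-indep | ⊥⊆ᵇ ⁅ e ⁆ | ∣⊥∣≡0 n = inj₂ tt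

    uniform-test : ∀ r → isUniform r 1 S ≡ (if indep M ⁅ e ⁆ then 1 ≤ᵇ r else not (1 ≤ᵇ r))
    uniform-test r rewrite ∣⁅x⁆∣≡1 e
                         | all-at (test r) (allSubsets n) (allSubsets-complete n ⁅ e ⁆) (passes-elsewhere r)
                         | ⊆ᵇ-refl ⁅ e ⁆ | ∣⁅x⁆∣≡1 e | ∧-identityʳ (indep M ⁅ e ⁆) = refl

    coloop-test : isUniform 1 1 S ≡ indep M ⁅ e ⁆
    coloop-test rewrite uniform-test 1 with indep M ⁅ e ⁆
    ... | true  = refl
    ... | false = refl

    loop-test : isUniform 0 1 S ≡ not (indep M ⁅ e ⁆)
    loop-test rewrite uniform-test 0 with indep M ⁅ e ⁆
    ... | true  = refl
    ... | false = refl

open Matroids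

module RingSums {c ℓ} (K : CommutativeRing c ℓ) where
  open CommutativeRing K hiding (refl; zero)
  open CommutativeRing K using () renaming (refl to ≈-refl)
  open MonoidSum +-monoid using (sum; sum-cong-≋) public
  open SetoidReasoning setoid

  ∑ : ∀ {a} {A : Set a} → (A → Carrier) → List A → Carrier
  ∑ f xs = sumR K (map f xs)

  ∑-cong : ∀ {a} {A : Set a} {f g : A → Carrier} xs → (∀ x → f x ≈ g x) → ∑ f xs ≈ ∑ g xs
  ∑-cong []       f≈g = ≈-refl
  ∑-cong (x ∷ xs) f≈g = +-cong (f≈g x) (∑-cong xs f≈g)

  ∑-zero : ∀ {a} {A : Set a} {f : A → Carrier} xs → (∀ x → f x ≈ 0#) → ∑ f xs ≈ 0#
  ∑-zero []       f≈0 = ≈-refl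
  ∑-zero (x ∷ xs) f≈0 = trans (+-cong (f≈0 x) (∑-zero xs f≈0)) (+-identityʳ 0#)

  ∑-++ : ∀ {a} {A : Set a} (f : A → Carrier) xs ys → ∑ f (xs ++ ys) ≈ ∑ f xs + ∑ f ys
  ∑-++ f []       ys = sym (+-identityˡ _)
  ∑-++ f (x ∷ xs) ys = trans (+-congˡ (∑-++ f xs ys)) (sym (+-assoc _ _ _))

  ∑-map : ∀ {a b} {A : Set a} {B : Set b} (f : B → Carrier) (g : A → B) xs →
          ∑ f (map g xs) ≡ ∑ (λ x → f (g x)) xs
  ∑-map f g []       = ≡.refl
  ∑-map f g (x ∷ xs) = cong (f (g x) +_) (∑-map f g xs)

  ∑-subsets-suc : ∀ n (f : Subset (suc n) → Carrier) →
    ∑ f (allSubsets (suc n)) ≈ ∑ (λ A → f (true ∷ A)) (allSubsets n) + ∑ (λ A → f (false ∷ A)) (allSubsets n)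
  ∑-subsets-suc n f = begin
    ∑ f (map (true ∷_) (allSubsets n) ++ map (false ∷_) (allSubsets n))
      ≈⟨ ∑-++ f (map (true ∷_) (allSubsets n)) (map (false ∷_) (allSubsets n)) ⟩
    ∑ f (map (true ∷_) (allSubsets n)) + ∑ f (map (false ∷_) (allSubsets n))
      ≡⟨ cong₂ _+_ (∑-map f (true ∷_) (allSubsets n)) (∑-map f (false ∷_) (allSubsets n)) ⟩
    ∑ (λ A → f (true ∷ A)) (allSubsets n) + ∑ (λ A → f (false ∷ A)) (allSubsets n) ∎

  ∑-subsets-⊥ : ∀ n (f : Subset n → Carrier) → (∀ A → A ≢ ⊥ → f A ≈ 0#) → ∑ f (allSubsets n) ≈ f ⊥
  ∑-subsets-⊥ zero    f vanish = +-identityʳ _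
  ∑-subsets-⊥ (suc n) f vanish = begin
    ∑ f (allSubsets (suc n))                   ≈⟨ ∑-subsets-suc n f ⟩
    ∑ (λ A → f (true ∷ A)) (allSubsets n) + ∑ (λ A → f (false ∷ A)) (allSubsets n)
      ≈⟨ +-cong (∑-zero (allSubsets n) (λ A → vanish (true ∷ A) λ ()))
                (∑-subsets-⊥ n (λ A → f (false ∷ A)) (λ A A≢⊥ → vanish (false ∷ A) (A≢⊥ ∘ cong tail))) ⟩
    0# + f ⊥                                   ≈⟨ +-identityˡ _ ⟩
    f ⊥                                        ∎

  ∑-subsets-singletons : ∀ n (f : Subset n → Carrier) → (∀ A → ∣ A ∣ ≢ 1 → f A ≈ 0#) →
                         ∑ f (allSubsets n) ≈ sum (λ e → f ⁅ e ⁆)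
  ∑-subsets-singletons zero    f vanish = trans (+-identityʳ _) (vanish [] λ ())
  ∑-subsets-singletons (suc n) f vanish = trans (∑-subsets-suc n f) (+-cong
    (∑-subsets-⊥ n (λ A → f (true ∷ A)) λ A A≢⊥ → vanish (true ∷ A) (A≢⊥ ∘ ∣p∣≡0⇒p≡⊥ A ∘ cong ℕ.pred))
    (∑-subsets-singletons n (λ A → f (false ∷ A)) λ A → vanish (false ∷ A)))

  sum-indicator : ∀ {n} (E : Subset n) (x : Carrier) →
                  sum (λ e → if lookup E e then x else 0#) ≈ natCast K ∣ E ∣ * x
  sum-indicator []          x = sym (zeroˡ x)
  sum-indicator (true ∷ E)  x = begin
    x + sum (λ e → if lookup E e then x else 0#) ≈⟨ +-congˡ (sum-indicator E x) ⟩
    x + natCast K ∣ E ∣ * x                       ≈⟨ +-congʳ (sym (*-identityˡ x)) ⟩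
    1# * x + natCast K ∣ E ∣ * x                  ≈⟨ sym (distribʳ x 1# _) ⟩
    (1# + natCast K ∣ E ∣) * x                    ∎
  sum-indicator (false ∷ E) x = trans (+-identityˡ _) (sum-indicator E x)

  ∑-applyUpTo-last : ∀ m (g : ℕ → ℕ) (h : ℕ → Carrier) → (∀ j → j < m → h (g j) ≈ 0#) →
                     ∑ h (applyUpTo g (suc m)) ≈ h (g m)
  ∑-applyUpTo-last zero    g h vanish = +-identityʳ _
  ∑-applyUpTo-last (suc m) g h vanish = begin
    h (g 0) + ∑ h (applyUpTo (g ∘ suc) (suc m))
      ≈⟨ +-cong (vanish 0 (s≤s z≤n)) (∑-applyUpTo-last m (g ∘ suc) h (λ j j<m → vanish (suc j) (s≤s j<m))) ⟩
    0# + h (g (suc m)) ≈⟨ +-identityˡ _ ⟩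
    h (g (suc m))      ∎

module LoopColoopExponential {c ℓ c′ ℓ′} (k : Field c ℓ) (char0 : CharZero k)
  (K : CommutativeRing c′ ℓ′) (φ : Field.Carrier k → CommutativeRing.Carrier K)
  (a b : CommutativeRing.Carrier K) where

  open HopfExp k K φ char0
  open CommutativeRing K hiding (refl; zero)
  open CommutativeRing K using () renaming (refl to ≈-refl)
  open RingSums K
  open SetoidReasoning setoid

  δ : ∀ {n} → Fun n
  δ N = a * δcoloop N + b * δloop N

  fact : ℕ → Carrier
  fact zero    = 1#
  fact (suc j) = natCast K (suc j) * fact j

  weight : SetSystem n → Carrier
  weight M = pow K a (rank M) * pow K b (nullity M)

  powValue : ℕ → SetSystem n → Carrier
  powValue j M = if ∣ ground M ∣ ≡ᵇ j then fact j * weight M else 0#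

  loopCoefficient : SetSystem n → Fin n → Carrier
  loopCoefficient M e = if indep M ⁅ e ⁆ then a else b

  *-if : ∀ x t y → x * (if t then y else 0#) ≈ (if t then x * y else 0#)
  *-if x true  y = ≈-refl
  *-if x false y = zeroʳ x

  if-cong : ∀ t {x y} → x ≈ y → (if t then x else 0#) ≈ (if t then y else 0#)
  if-cong true  x≈y = x≈y
  if-cong false _   = ≈-refl

  x*[y*z]≈y*[x*z] : ∀ x y z → x * (y * z) ≈ y * (x * z)
  x*[y*z]≈y*[x*z] x y z = begin
    x * (y * z) ≈⟨ sym (*-assoc x y z) ⟩
    (x * y) * z ≈⟨ *-congʳ (*-comm x y) ⟩
    (y * x) * z ≈⟨ *-assoc y x z ⟩
    y * (x * z) ∎

  δ-uniform : (N : SetSystem n) (t : Bool) → isUniform 1 1 N ≡ t → isUniform 0 1 N ≡ not t →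
              δ N ≈ (if t then a else b)
  δ-uniform N true  coloop loop rewrite coloop | loop = trans (+-cong (*-identityʳ a) (zeroʳ b)) (+-identityʳ a)
  δ-uniform N false coloop loop rewrite coloop | loop = trans (+-cong (zeroʳ a) (*-identityʳ b)) (+-identityˡ b)

  δ-single : (M : SetSystem n) → T (indep M ⊥) → ∀ {e} → e ∈ ground M →
             δ (restrict M ⁅ e ⁆) ≈ loopCoefficient M e
  δ-single M ∅-indep {e} e∈E = begin
    δ (restrict M ⁅ e ⁆) ≡⟨ cong δ (restrict-≡ M ⁅ e ⁆ (⁅⁆-⊆ e∈E)) ⟩
    δ S                  ≈⟨ δ-uniform S (indep M ⁅ e ⁆) coloop-test loop-test ⟩
    loopCoefficient M e  ∎
    where open SingleRestriction M ∅-indep e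

  δ-neither : (N : SetSystem n) → isUniform 1 1 N ≡ false → isUniform 0 1 N ≡ false → δ N ≈ 0#
  δ-neither N not-coloop not-loop rewrite not-coloop | not-loop =
    trans (+-cong (zeroʳ a) (zeroʳ b)) (+-identityʳ 0#)

  δ-vanishes : (M : SetSystem n) (A : Subset n) → A ⊆ ground M → ∣ A ∣ ≢ 1 → δ (restrict M A) ≈ 0#
  δ-vanishes M A A⊆E ∣A∣≢1 =
    δ-neither (restrict M A) (uniform-size 1 (restrict M A) ∣E∣≢1) (uniform-size 0 (restrict M A) ∣E∣≢1)
    where ∣E∣≢1 : ∣ ground (restrict M A) ∣ ≢ 1
          ∣E∣≢1 = ∣A∣≢1 ∘ ≡.trans (cong ∣_∣ (≡.sym (──-cancel (ground M) A A⊆E)))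

  weight-contract : (M : SetSystem n) → IsMatroid M → ∀ {e} → e ∈ ground M →
                    loopCoefficient M e * weight (contract M ⁅ e ⁆) ≈ weight M
  weight-contract M isM {e} e∈E with indep M ⁅ e ⁆ in e-test
  ... | true  = begin
      a * (pow K a (rank C) * pow K b (nullity C)) ≈⟨ sym (*-assoc a _ _) ⟩
      pow K a (suc (rank C)) * pow K b (nullity C) ≡⟨ cong₂ (λ r m → pow K a r * pow K b m)
                                                          (≡.sym rank≡) (≡.sym nullity≡) ⟩
      weight M                                     ∎
    where open ContractElement M isM e e∈E
          rank≡ : rank M ≡ suc (rank C)
          rank≡ = proj₁ (nonloop-contract (subst T (≡.sym e-test) tt))
          nullity≡ : nullity M ≡ nullity C
          nullity≡ = proj₂ (nonloop-contract (subst T (≡.sym e-test) tt))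
  ... | false = begin
      b * (pow K a (rank C) * pow K b (nullity C)) ≈⟨ x*[y*z]≈y*[x*z] b _ _ ⟩
      pow K a (rank C) * pow K b (suc (nullity C)) ≡⟨ cong₂ (λ r m → pow K a r * pow K b m)
                                                          (≡.sym rank≡) (≡.sym nullity≡) ⟩
      weight M                                     ∎
    where open ContractElement M isM e e∈E
          rank≡ : rank M ≡ rank C
          rank≡ = proj₁ (loop-contract (subst T e-test))
          nullity≡ : nullity M ≡ suc (nullity C)
          nullity≡ = proj₂ (loop-contract (subst T e-test))

  weight-empty : (M : SetSystem n) → IsMatroid M → ∣ ground M ∣ ≡ 0 → weight M ≈ 1#
  weight-empty M isM ∣E∣≡0 = begin
    pow K a (rank M) * pow K b (nullity M) ≡⟨ cong₂ (λ r m → pow K a r * pow K b m) rank≡0 nullity≡0 ⟩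
    1# * 1#                                ≈⟨ *-identityʳ 1# ⟩
    1#                                     ∎
    where
      open MatroidFacts M isM using (rank≤∣ground∣)
      rank≡0 : rank M ≡ 0
      rank≡0 = n≤0⇒n≡0 (subst (rank M ≤_) ∣E∣≡0 rank≤∣ground∣)
      nullity≡0 : nullity M ≡ 0
      nullity≡0 = cong₂ _∸_ ∣E∣≡0 rank≡0

  singleton-term : ∀ j → (∀ {m} (N : SetSystem m) → IsMatroid N → ⋆pow δ j N ≈ powValue j N) →
    ∀ {n} (M : SetSystem n) → IsMatroid M → ∀ {e} → e ∈ ground M →
    δ (restrict M ⁅ e ⁆) * ⋆pow δ j (contract M ⁅ e ⁆) ≈
    (if ∣ ground M ∣ ≡ᵇ suc j then fact j * weight M else 0#)
  singleton-term j IH {n} M isM {e} e∈E = begin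
    δ (restrict M ⁅ e ⁆) * ⋆pow δ j C
      ≈⟨ *-cong (δ-single M (IsMatroid.indep-∅ isM) e∈E) (IH C contract-isMatroid) ⟩
    loopCoefficient M e * (if ∣ E-e ∣ ≡ᵇ j then fact j * weight C else 0#)
      ≈⟨ *-if (loopCoefficient M e) (∣ E-e ∣ ≡ᵇ j) _ ⟩
    (if ∣ E-e ∣ ≡ᵇ j then loopCoefficient M e * (fact j * weight C) else 0#)
      ≈⟨ if-cong (∣ E-e ∣ ≡ᵇ j)
           (trans (x*[y*z]≈y*[x*z] _ _ _) (*-congˡ (weight-contract M isM e∈E))) ⟩
    (if ∣ E-e ∣ ≡ᵇ j then fact j * weight M else 0#)
      ≡⟨ cong (λ m → if m ≡ᵇ suc j then fact j * weight M else 0#) (∣p─⁅x⁆∣ (ground M) e e∈E) ⟩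
    (if ∣ ground M ∣ ≡ᵇ suc j then fact j * weight M else 0#) ∎
    where
      open ContractElement M isM e e∈E using (C; contract-isMatroid)
      E-e : Subset n
      E-e = ground M ─ ⁅ e ⁆

  ⋆pow-formula : ∀ j {n} (M : SetSystem n) → IsMatroid M → ⋆pow δ j M ≈ powValue j M
  ⋆pow-formula zero M isM with ∣ ground M ∣ ≡ᵇ 0 in ∣E∣≡ᵇ0
  ... | false = ≈-refl
  ... | true  = trans (sym (weight-empty M isM (≡ᵇ⇒≡ _ 0 (subst T (≡.sym ∣E∣≡ᵇ0) tt)))) (sym (*-identityˡ _))
  ⋆pow-formula (suc j) {n} M isM = begin
    ∑ term (allSubsets n)                    ≈⟨ ∑-subsets-singletons n term term-vanishes ⟩
    sum (λ e → term ⁅ e ⁆)                   ≈⟨ sum-cong-≋ term-at-singleton ⟩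
    sum (λ e → if lookup E e then t else 0#) ≈⟨ sum-indicator E t ⟩
    natCast K ∣ E ∣ * t                      ≈⟨ count-terms ⟩
    powValue (suc j) M                       ∎
    where
      E : Subset n
      E = ground M
      term : Subset n → Carrier
      term A = if A ⊆ᵇ E then δ (restrict M A) * ⋆pow δ j (contract M A) else 0#
      t : Carrier
      t = if ∣ E ∣ ≡ᵇ suc j then fact j * weight M else 0#

      term-vanishes : ∀ A → ∣ A ∣ ≢ 1 → term A ≈ 0#
      term-vanishes A ∣A∣≢1 with A ⊆ᵇ E in A⊆?E
      ... | false = ≈-refl
      ... | true  = trans (*-congʳ (δ-vanishes M A (⊆ᵇ⇒⊆ (subst T (≡.sym A⊆?E) tt)) ∣A∣≢1)) (zeroˡ _)

      term-at-singleton : ∀ e → term ⁅ e ⁆ ≈ (if lookup E e then t else 0#)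
      term-at-singleton e with lookup E e in e∈?E
      ... | false rewrite ¬T⇒≡false {⁅ e ⁆ ⊆ᵇ E} 
              (λ e⊆E → subst T (≡.trans (≡.sym ([]=⇒lookup (⊆ᵇ⇒⊆ e⊆E (x∈⁅x⁆ e)))) e∈?E) tt) =
            ≈-refl
      ... | true rewrite T⇒≡true (⊆⇒⊆ᵇ {p = ⁅ e ⁆} {q = E} (⁅⁆-⊆ (lookup⇒[]= e E e∈?E))) =
            singleton-term j (⋆pow-formula j) M isM (lookup⇒[]= e E e∈?E)

      count-terms : natCast K ∣ E ∣ * t ≈ powValue (suc j) M
      count-terms with ∣ E ∣ ≡ᵇ suc j in ∣E∣≡ᵇ
      ... | false = zeroʳ _
      ... | true  = begin
        natCast K ∣ E ∣ * (fact j * weight M)     ≡⟨ cong (λ m → natCast K m * (fact j * weight M)) ∣E∣≡ ⟩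
        natCast K (suc j) * (fact j * weight M)   ≈⟨ sym (*-assoc _ _ _) ⟩
        fact (suc j) * weight M                   ∎
        where ∣E∣≡ : ∣ E ∣ ≡ suc j
              ∣E∣≡ = ≡ᵇ⇒≡ ∣ E ∣ (suc j) (subst T (≡.sym ∣E∣≡ᵇ) tt)

  module _ (hom : IsRingHomomorphism (Field.rawRing k) (CommutativeRing.rawRing K) φ) where
    private module k = Field k
    open IsRingHomomorphism hom using (⟦⟧-cong; +-homo; 0#-homo; *-homo; 1#-homo)

    natCast-homo : ∀ m → φ (natCast k.commutativeRing m) ≈ natCast K m
    natCast-homo zero    = 0#-homo
    natCast-homo (suc m) = trans (+-homo _ _) (+-cong 1#-homo (natCast-homo m))

    invFact-fact : ∀ j → φ (invFact j) * fact j ≈ 1#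
    invFact-fact zero    = trans (*-identityʳ _) 1#-homo
    invFact-fact (suc j) = begin
      φ (invFact j k.* j+1⁻¹) * (natCast K (suc j) * fact j)   ≈⟨ *-congʳ (*-homo _ _) ⟩
      (φ (invFact j) * φ j+1⁻¹) * (natCast K (suc j) * fact j) ≈⟨ *-assoc _ _ _ ⟩
      φ (invFact j) * (φ j+1⁻¹ * (natCast K (suc j) * fact j)) ≈⟨ *-congˡ (sym (*-assoc _ _ _)) ⟩
      φ (invFact j) * ((φ j+1⁻¹ * natCast K (suc j)) * fact j) ≈⟨ *-congˡ (*-congʳ j+1⁻¹*[j+1]≈1) ⟩
      φ (invFact j) * (1# * fact j)                            ≈⟨ *-congˡ (*-identityˡ _) ⟩
      φ (invFact j) * fact j                                   ≈⟨ invFact-fact j ⟩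
      1#                                                       ∎
      where
        j+1 : k.Carrier
        j+1 = natCast k.commutativeRing (suc j)
        j+1⁻¹ : k.Carrier
        j+1⁻¹ = k.inv j+1 (char0 j)
        j+1⁻¹*[j+1]≈1 : φ j+1⁻¹ * natCast K (suc j) ≈ 1#
        j+1⁻¹*[j+1]≈1 = begin
          φ j+1⁻¹ * natCast K (suc j) ≈⟨ *-congˡ (sym (natCast-homo (suc j))) ⟩
          φ j+1⁻¹ * φ j+1             ≈⟨ sym (*-homo _ _) ⟩
          φ (j+1⁻¹ k.* j+1)           ≈⟨ ⟦⟧-cong (k.trans (k.*-comm _ _) (k.inverse j+1 (char0 j))) ⟩
          φ k.1#                      ≈⟨ 1#-homo ⟩
          1#                          ∎

    exp-formula : (M : SetSystem n) → IsMatroid M → exp⋆ δ M ≈ weight M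
    exp-formula M isM = begin
      ∑ (λ j → φ (invFact j) * ⋆pow δ j M) (upTo (suc m))
        ≈⟨ ∑-cong (upTo (suc m)) (λ j → *-congˡ (⋆pow-formula j M isM)) ⟩
      ∑ term (upTo (suc m))            ≈⟨ ∑-applyUpTo-last m (λ j → j) term smaller-vanish ⟩
      φ (invFact m) * powValue m M     ≡⟨ cong (λ t → φ (invFact m) * (if t then fact m * weight M else 0#))
                                               (T⇒≡true (≡⇒≡ᵇ m m refl)) ⟩
      φ (invFact m) * (fact m * weight M) ≈⟨ sym (*-assoc _ _ _) ⟩
      (φ (invFact m) * fact m) * weight M ≈⟨ *-congʳ (invFact-fact m) ⟩
      1# * weight M                       ≈⟨ *-identityˡ _ ⟩
      weight M                            ∎
      where
        m : ℕ
        m = ∣ ground M ∣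
        term : ℕ → Carrier
        term j = φ (invFact j) * powValue j M
        smaller-vanish : ∀ j → j < m → term j ≈ 0#
        smaller-vanish j j<m with m ≡ᵇ j in m≡ᵇj
        ... | false = zeroʳ _
        ... | true  = ⊥-elim (<⇒≢ j<m (≡.sym (≡ᵇ⇒≡ m j (subst T (≡.sym m≡ᵇj) tt))))

mainTheorem3 : ∀ {c ℓ c' ℓ'} (k : Field c ℓ) (char0 : CharZero k)
    (K : CommutativeRing c' ℓ')
    (φ : Field.Carrier k → CommutativeRing.Carrier K)
    → IsRingHomomorphism (Field.rawRing k) (CommutativeRing.rawRing K) φ
    → (a b : CommutativeRing.Carrier K)
    → (n : ℕ) (M : SetSystem n) → IsMatroid M
    → CommutativeRing._≈_ K
        (HopfExp.exp⋆ k K φ char0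
          (λ N → CommutativeRing._+_ K
                   (CommutativeRing._*_ K a (HopfExp.δcoloop k K φ char0 N))
                   (CommutativeRing._*_ K b (HopfExp.δloop k K φ char0 N)))
          M)
        (CommutativeRing._*_ K (pow K a (rank M)) (pow K b (nullity M)))
mainTheorem3 k char0 K φ hom a b n M isM =
  LoopColoopExponential.exp-formula k char0 K φ a b hom M isM
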